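{- Let $x,y:\mathbb{R}_D$ be equipped with locators. Then there is a function $(x<y)\to\sum_{q:\mathbb{Q}}(x<q)\times(q<y)$.
   Context: Work in Martin-Löf type theory with propositional truncation, function extensionality and propositional extensionality. A Dedekind real is a pair $x=(L,U)$ of proposition-valued predicates on $\mathbb{Q}$, writing $q<x$ for $q\in L$ and $x<r$ for $r\in U$, which is bounded, rounded, transitive and located ($q<r\Rightarrow\|(q<x)+(x<r)\|$). $\mathbb{R}_D$ is the type of Dedekind reals. For $x,y:\mathbb{R}_D$, $x<y$ is the proposition $\exists_{q:\mathbb{Q}}(x<q)\land(q<y)$ (truncated existence). A locator for $x$ is a function $\prod_{q,r:\mathbb{Q}}(q<r)\to(q<x)+(x<r)$ into the untruncated disjoint sum. -}

module Defs where

open import Level using (Level; suc; _⊔_; 0ℓ)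
open import Data.Rational using (ℚ; _<_)
open import Data.Product using (Σ; _×_; _,_)
open import Data.Sum using (_⊎_)
open import Relation.Binary.PropositionalEquality using (_≡_)
open import Function using (_↔_)

isProp : ∀ {ℓ} → Set ℓ → Set ℓ
isProp A = (a b : A) → a ≡ b

-- The ambient type theory: propositional truncation (as an abstract
-- operation with its introduction rule, propositionality and recursion
-- principle into propositions), function extensionality and
-- propositional extensionality.  Statements are quantified over any such
-- structure, since --safe Agda has no built-in truncation.
record Ambient : Set₁ where
  field
    ∥_∥      : Set → Set
    ∣_∣      : {A : Set} → A → ∥ A ∥
    ∥∥-isProp : {A : Set} → isProp ∥ A ∥
    ∥∥-rec   : {A P : Set} → isProp P → (A → P) → ∥ A ∥ → P
    funext   : {A : Set} {B : A → Set} {f g : (a : A) → B a} →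
               ((a : A) → f a ≡ g a) → f ≡ g
    propext  : {A B : Set} → isProp A → isProp B → (A → B) → (B → A) → A ≡ B

module Reals (T : Ambient) where
  open Ambient T

  ∃∥ : (A : Set) → (A → Set) → Set
  ∃∥ A P = ∥ Σ A P ∥

  -- Dedekind reals: pairs (L , U) of proposition-valued predicates on ℚ,
  -- writing q < x for L q and x < r for U r.
  record ℝD : Set₁ where
    field
      L : ℚ → Set
      U : ℚ → Set
      L-isProp : (q : ℚ) → isProp (L q)
      U-isProp : (r : ℚ) → isProp (U r)
      bounded-L : ∃∥ ℚ L
      bounded-U : ∃∥ ℚ U
      rounded-L : (q : ℚ) → (L q → ∃∥ ℚ (λ q' → (q < q') × L q'))
                              × (∃∥ ℚ (λ q' → (q < q') × L q') → L q)
      rounded-U : (r : ℚ) → (U r → ∃∥ ℚ (λ r' → (r' < r) × U r'))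
                              × (∃∥ ℚ (λ r' → (r' < r) × U r') → U r)
      transitive : (q r : ℚ) → L q → U r → q < r
      located : (q r : ℚ) → q < r → ∥ L q ⊎ U r ∥

  open ℝD public

  _<ℝ_ : ℝD → ℝD → Set
  x <ℝ y = ∃∥ ℚ (λ q → U x q × L y q)

  Locator : ℝD → Set
  Locator x = (q r : ℚ) → q < r → L x q ⊎ U x r

module Submission where

-- The proposition x < y only says that a rational
-- strictly between x and y merely exists; to produce one we combine two
-- facts.
--   (1) Constructive choice for searchable types: if a type A comes with a
--       bounded enumeration (finite stages exhausting A) and P is a
--       decidable predicate on A, then ∥ Σ A P ∥ → Σ A P.  On ℕ this holds
--       because the least witness of a decidable predicate forms a
--       proposition, so truncation elimination applies; for A it follows
--       by searching the stages.  Bounded enumerations exist for ℕ and are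
--       stable under sums, products and retracts, hence exist for ℤ, ℚ and
--       ℚ × ℚ × ℚ.
--   (2) The locators give a decidable test for x < q < y on triples: for s < q < t
--       we ask the locator of x about s < q and that of y about q < t; if
--       they answer "x < q" and "q < y" we have a certified separator.  The
--       test succeeds on some triple whenever x < y,
--       because roundedness gives x < s < q < t < y.
-- The theorem applies (1) to the test (2) on ℚ × ℚ × ℚ.

open import Defs
open import Data.Rational using (ℚ)
open import Data.Product using (Σ; _×_)
open import Data.Product using (_,_; proj₁; proj₂)
open import Data.Sum using (_⊎_; inj₁; inj₂; [_,_])
open import Data.Bool.Properties using (T-irrelevant)
open import Data.Nat using (ℕ; suc; _≤_; _<_; _⊔_; s≤s)
open import Data.Nat.Properties using (<-cmp; ≤-refl; anyUpTo?; m⊔n≤o⇒m≤o; m⊔n≤o⇒n≤o)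
open import Data.Nat.Induction using (<-rec)
open import Data.Integer using (ℤ; +_; -[1+_])
import Data.Rational as ℚ
open import Data.Rational.Properties using (↥p/↧p≡p; _<?_; <-irrefl)
open import Data.List using (List; map; _++_; upTo; cartesianProduct)
open import Data.List.Relation.Unary.Any using (Any; any?; satisfied)
open import Data.List.Membership.Propositional using (_∈_; lose)
open import Data.List.Membership.Propositional.Properties
  using (∈-map⁺; ∈-++⁺ˡ; ∈-++⁺ʳ; ∈-upTo⁺; ∈-cartesianProduct⁺)
open import Data.Maybe using (Maybe; just; nothing; Is-just; to-witness)
import Data.Maybe.Relation.Unary.Any as Maybe
open import Data.Unit using (tt)
open import Data.Empty using (⊥-elim)
open import Relation.Nullary using (yes; no; ¬_)
open import Relation.Nullary.Decidable
  using (True; False; toWitness; fromWitness; toWitnessFalse; fromWitnessFalse)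
open import Relation.Unary using (Decidable)
open import Relation.Binary using (tri<; tri≈; tri>)
open import Relation.Binary.PropositionalEquality using (_≡_; refl; subst)

record BoundedEnumeration (A : Set) : Set where
  field
    stage  : ℕ → List A
    size   : A → ℕ
    covers : ∀ {a n} → size a ≤ n → a ∈ stage n

open BoundedEnumeration

enumℕ : BoundedEnumeration ℕ
enumℕ = record { stage = λ n → upTo (suc n) ; size = λ a → a ; covers = λ a≤n → ∈-upTo⁺ (s≤s a≤n) }

enum⊎ : {A B : Set} → BoundedEnumeration A → BoundedEnumeration B → BoundedEnumeration (A ⊎ B)
enum⊎ {A} {B} eA eB = record { stage = stage⊎ ; size = [ size eA , size eB ] ; covers = covers⊎ }
  where
  stage⊎ : ℕ → List (A ⊎ B)
  stage⊎ n = map inj₁ (stage eA n) ++ map inj₂ (stage eB n)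

  covers⊎ : ∀ {c n} → [ size eA , size eB ] c ≤ n → c ∈ stage⊎ n
  covers⊎ {inj₁ a} h = ∈-++⁺ˡ (∈-map⁺ inj₁ (covers eA h))
  covers⊎ {inj₂ b} {n} h = ∈-++⁺ʳ (map inj₁ (stage eA n)) (∈-map⁺ inj₂ (covers eB h))

enum× : {A B : Set} → BoundedEnumeration A → BoundedEnumeration B → BoundedEnumeration (A × B)
enum× eA eB = record
  { stage  = λ n → cartesianProduct (stage eA n) (stage eB n)
  ; size   = λ (a , b) → size eA a ⊔ size eB b
  ; covers = λ {(a , b)} h →
      ∈-cartesianProduct⁺ (covers eA (m⊔n≤o⇒m≤o (size eA a) _ h)) (covers eB (m⊔n≤o⇒n≤o _ (size eB b) h))
  }

enumRetract : {A B : Set} (f : B → A) (g : A → B) → (∀ a → f (g a) ≡ a) →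
              BoundedEnumeration B → BoundedEnumeration A
enumRetract f g f∘g≡id eB = record
  { stage  = λ n → map f (stage eB n)
  ; size   = λ a → size eB (g a)
  ; covers = λ {a} h → subst (_∈ _) (f∘g≡id a) (∈-map⁺ f (covers eB h))
  }

enumℤ : BoundedEnumeration ℤ
enumℤ = enumRetract [ +_ , -[1+_] ] sign-split sign-split-section (enum⊎ enumℕ enumℕ)
  where
  sign-split : ℤ → ℕ ⊎ ℕ
  sign-split (+ n)    = inj₁ n
  sign-split -[1+ n ] = inj₂ n

  sign-split-section : ∀ z → [ +_ , -[1+_] ] (sign-split z) ≡ z
  sign-split-section (+ n)    = refl
  sign-split-section -[1+ n ] = refl

enumℚ : BoundedEnumeration ℚ
enumℚ = enumRetract fraction (λ p → ℚ.↥ p , ℚ.ℚ.denominator-1 p) ↥p/↧p≡p (enum× enumℤ enumℕ)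
  where
  fraction : ℤ × ℕ → ℚ
  fraction (a , b) = a ℚ./ suc b

module Choice (T : Ambient) where
  open Ambient T

  -- Both conditions are phrased as truth values of
  -- decisions, so they are propositions without any extensionality.
  module LeastWitness {P : ℕ → Set} (P? : Decidable P) where
    IsLeast : ℕ → Set
    IsLeast n = True (P? n) × False (anyUpTo? P? n)

    least-unique : ∀ {m n} → IsLeast m → IsLeast n → m ≡ n
    least-unique {m} {n} (Pm , none<m) (Pn , none<n) with <-cmp m n
    ... | tri< m<n _ _ = ⊥-elim (toWitnessFalse none<n (m , m<n , toWitness Pm))
    ... | tri≈ _ m≡n _ = m≡n
    ... | tri> _ _ n<m = ⊥-elim (toWitnessFalse none<m (n , n<m , toWitness Pn))

    least-isProp : isProp (Σ ℕ IsLeast)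
    least-isProp (m , Pm , none<m) (n , Pn , none<n) with least-unique (Pm , none<m) (Pn , none<n)
    ... | refl rewrite T-irrelevant Pm Pn | T-irrelevant none<m none<n = refl

    least-from : ∀ n → P n → Σ ℕ IsLeast
    least-from = <-rec (λ n → P n → Σ ℕ IsLeast) descend
      where
      descend : ∀ n → (∀ {m} → m < n → P m → Σ ℕ IsLeast) → P n → Σ ℕ IsLeast
      descend n below Pn with anyUpTo? P? n
      ... | yes (m , m<n , Pm) = below m<n Pm
      ... | no none<n = n , fromWitness Pn , fromWitnessFalse none<n

    least-witness : Σ ℕ IsLeast → Σ ℕ P
    least-witness (n , Pn , _) = n , toWitness Pn

  ℕ-choice : {P : ℕ → Set} → Decidable P → ∥ Σ ℕ P ∥ → Σ ℕ P
  -- The least witness is a proposition, so it can be extracted from ∥ Σ ℕ P ∥.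
  ℕ-choice P? ∃n = least-witness (∥∥-rec least-isProp (λ (n , Pn) → least-from n Pn) ∃n)
    where open LeastWitness P?

  search : {A : Set} {P : A → Set} → BoundedEnumeration A → Decidable P → ∥ Σ A P ∥ → Σ A P
  search {A} {P} e P? ∃a = satisfied (proj₂ (ℕ-choice (λ n → any? P? (stage e n)) ∃stage))
    where
    witness-stage : Σ A P → Σ ℕ (λ n → Any P (stage e n))
    witness-stage (a , Pa) = size e a , lose (covers e ≤-refl) Pa

    ∃stage : ∥ Σ ℕ (λ n → Any P (stage e n)) ∥
    ∃stage = ∥∥-rec ∥∥-isProp (λ w → ∣ witness-stage w ∣) ∃a

module Separation (T : Ambient) where
  open Ambient T
  open Reals T

  not-both : (z : ℝD) {s : ℚ} → L z s → ¬ U z s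
  not-both z {s} s<z z<s = <-irrefl refl (transitive z s s s<z z<s)

  module LocatorTest (x y : ℝD) (lx : Locator x) (ly : Locator y) where
    middle : ℚ × ℚ × ℚ → ℚ
    middle (_ , q , _) = q

    combine : {s q t : ℚ} → L x s ⊎ U x q → L y q ⊎ U y t → Maybe (U x q × L y q)
    combine (inj₂ x<q) (inj₁ q<y) = just (x<q , q<y)
    combine _          _          = nothing

    test : (τ : ℚ × ℚ × ℚ) → Maybe (U x (middle τ) × L y (middle τ))
    test (s , q , t) with s <? q | q <? t
    ... | yes s<q | yes q<t = combine (lx s q s<q) (ly q t q<t)
    ... | _       | _       = nothing

    combine-succeeds : {s q t : ℚ} → U x s → L y t →
                       (a : L x s ⊎ U x q) (b : L y q ⊎ U y t) → Is-just (combine a b)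
    combine-succeeds x<s _   (inj₁ s<x) _          = ⊥-elim (not-both x s<x x<s)
    combine-succeeds _   t<y (inj₂ _)   (inj₂ y<t) = ⊥-elim (not-both y t<y y<t)
    combine-succeeds _   _   (inj₂ _)   (inj₁ _)   = Maybe.just tt

    test-succeeds : {s q t : ℚ} → U x s → L y t → s ℚ.< q → q ℚ.< t → Is-just (test (s , q , t))
    test-succeeds {s} {q} {t} x<s t<y s<q q<t with s <? q | q <? t
    ... | yes s<q′ | yes q<t′ = combine-succeeds x<s t<y (lx s q s<q′) (ly q t q<t′)
    ... | no s≮q   | _        = ⊥-elim (s≮q s<q)
    ... | yes _    | no q≮t   = ⊥-elim (q≮t q<t)

    -- If x < y, the test succeeds on some triple: by roundedness a
    -- separator q can be widened to x < s < q < t < y.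
    test-succeeds-somewhere : x <ℝ y → ∥ Σ (ℚ × ℚ × ℚ) (λ τ → Is-just (test τ)) ∥
    test-succeeds-somewhere = ∥∥-rec ∥∥-isProp λ (q , x<q , q<y) →
      ∥∥-rec ∥∥-isProp (λ (s , s<q , x<s) →
      ∥∥-rec ∥∥-isProp (λ (t , q<t , t<y) →
        ∣ (s , q , t) , test-succeeds x<s t<y s<q q<t ∣)
        (proj₁ (rounded-L y q) q<y))
        (proj₁ (rounded-U x q) x<q)

    separator : Σ (ℚ × ℚ × ℚ) (λ τ → Is-just (test τ)) → Σ ℚ (λ q → U x q × L y q)
    separator (τ , passes) = middle τ , to-witness passes

lemma3p22 : (T : Ambient) → let open Reals T in
    (x y : ℝD) → Locator x → Locator y →
    x <ℝ y → Σ ℚ (λ q → U x q × L y q)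
lemma3p22 T x y lx ly x<y = separator (search enumℚ³ test? (test-succeeds-somewhere x<y))
  where
  open Choice T
  open Separation.LocatorTest T x y lx ly

  enumℚ³ : BoundedEnumeration (ℚ × ℚ × ℚ)
  enumℚ³ = enum× enumℚ (enum× enumℚ enumℚ)

  test? : Decidable (λ τ → Is-just (test τ))
  test? τ = Maybe.dec (λ _ → yes tt) (test τ)
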